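{- Let $P$ be a finite graded poset of rank $r$ such that $J(P)$ is tCDE. Then the edge density of $J(P)$ is $\mathbb{E}(\mathrm{uni}_{J(P)};\mathrm{ddeg})=\frac{\#P}{r+2}$.
   Context: $P$ is graded of rank $r$ if all maximal chains of $P$ have length $r$. $J(P)$ is the set of order ideals of $P$ ordered by inclusion; $\mathrm{ddeg}(I)$ is the number of elements of $J(P)$ covered by $I$; $\mathrm{uni}$ is uniform; $\mathbb{E}(\mu;f)=\sum_I f(I)\mu(I)$. For $I\in J(P)$, $p\in P$: $\mathcal{T}^+_p(I)=1$ if $p\notin I$ and $p$ minimal in $P\setminus I$, else 0; $\mathcal{T}^-_p(I)=1$ if $p\in I$ maximal in $I$, else 0. A distribution $\mu$ on $J(P)$ is toggle-symmetric if $\mathbb{E}(\mu;\mathcal{T}^+_p)=\mathbb{E}(\mu;\mathcal{T}^-_p)$ for all $p$; $J(P)$ is tCDE if $\mathbb{E}(\mu;\mathrm{ddeg})=\mathbb{E}(\mathrm{uni};\mathrm{ddeg})$ for all toggle-symmetric $\mu$. -}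

module Defs where

open import Data.Bool using (Bool; true; false; not; _∧_; _∨_; T)
open import Data.Bool.Properties using (∨-zeroʳ)
open import Data.Nat as ℕ using (ℕ; zero; suc)
open import Data.Integer using (+_)
open import Data.Fin using (Fin; zero; suc)
open import Data.Fin.Subset using (Subset; ⊥)
open import Data.Vec using (Vec; []; _∷_; lookup)
open import Data.Vec.Properties using (lookup-replicate)
open import Data.List using (List; []; _∷_; _++_; map; length; filterᵇ; foldr)
open import Data.Bool.ListAction using (any)
open import Data.Fin using () renaming (_≟_ to _≟ᶠ_)
open import Relation.Nullary.Decidable using (isYes)
open import Data.List.Membership.Propositional using () renaming (_∉_ to _∉ˡ_)
open import Data.List.Relation.Unary.Linked using (Linked)
open import Data.List.Relation.Unary.Any using (Any)
open import Data.Product using (Σ; _×_; _,_)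
open import Data.Sum using (_⊎_)
open import Data.Rational using (ℚ; 0ℚ; _/_; _*_; _+_; _≤_)
open import Relation.Binary.PropositionalEquality using (_≡_; _≢_; refl; cong)
open import Relation.Nullary using (¬_)

record FinPoset : Set where
  field
    size    : ℕ
    leq     : Fin size → Fin size → Bool
    refl≤   : ∀ x → T (leq x x)
    antisym : ∀ x y → T (leq x y) → T (leq y x) → x ≡ y
    trans≤  : ∀ x y z → T (leq x y) → T (leq y z) → T (leq x z)

allFinᵇ : ∀ {m} → (Fin m → Bool) → Bool
allFinᵇ {zero}  f = true
allFinᵇ {suc m} f = f zero ∧ allFinᵇ (λ i → f (suc i))

allFinᵇ-true : ∀ {m} (f : Fin m → Bool) → (∀ i → f i ≡ true) → allFinᵇ f ≡ true
allFinᵇ-true {zero}  f h = refl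
allFinᵇ-true {suc m} f h rewrite h zero = allFinᵇ-true (λ i → f (suc i)) (λ i → h (suc i))

allSubsets : ∀ m → List (Subset m)
allSubsets zero    = [] ∷ []
allSubsets (suc m) = map (false ∷_) (allSubsets m) ++ map (true ∷_) (allSubsets m)

allSubsets-⊥ : ∀ m → Σ (List (Subset m)) λ rest → allSubsets m ≡ ⊥ ∷ rest
allSubsets-⊥ zero = [] , refl
allSubsets-⊥ (suc m) with allSubsets-⊥ m
... | rest , eq rewrite eq = _ , refl

⊆ᵇ : ∀ {m} → Subset m → Subset m → Bool
⊆ᵇ A B = allFinᵇ (λ i → not (lookup A i) ∨ lookup B i)

⊂ᵇ : ∀ {m} → Subset m → Subset m → Bool
⊂ᵇ A B = ⊆ᵇ A B ∧ not (⊆ᵇ B A)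

ℕ→ℚ : ℕ → ℚ
ℕ→ℚ k = (+ k) / 1

sumℚ : List ℚ → ℚ
sumℚ = foldr _+_ 0ℚ

module _ (P : FinPoset) where
  open FinPoset P

  _≼_ : Fin size → Fin size → Set
  x ≼ y = T (leq x y)

  _≺_ : Fin size → Fin size → Set
  x ≺ y = x ≼ y × x ≢ y

  Comparable : Fin size → Fin size → Set
  Comparable x y = (x ≼ y) ⊎ (y ≼ x)

  IsChain : List (Fin size) → Set
  IsChain = Linked _≺_

  IsMaximalChain : List (Fin size) → Set
  IsMaximalChain c = IsChain c × (∀ p → p ∉ˡ c → Any (λ x → ¬ Comparable p x) c)

  -- A chain with k+1 elements has length k.  P is graded of rank r if
  -- every maximal chain has length r, i.e. has exactly r+1 elements.
  Graded : ℕ → Set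
  Graded r = ∀ c → IsMaximalChain c → length c ≡ suc r

  isIdeal : Subset size → Bool
  isIdeal S = allFinᵇ (λ p → allFinᵇ (λ q → not (leq q p) ∨ not (lookup S p) ∨ lookup S q))

  J : List (Subset size)
  J = filterᵇ isIdeal (allSubsets size)

  coversᵇ : Subset size → Subset size → Bool
  coversᵇ I' I = ⊂ᵇ I' I ∧ not (any (λ K → ⊂ᵇ I' K ∧ ⊂ᵇ K I) J)

  ddeg : Subset size → ℕ
  ddeg I = length (filterᵇ (λ I' → coversᵇ I' I) J)

  -- Toggleability statistics
  -- T⁺_p(I) = 1 iff p ∉ I and p is minimal in P ∖ I
  T⁺ : Fin size → Subset size → ℕ
  T⁺ p I with lookup I p
  ... | true  = 0
  ... | false with allFinᵇ (λ q → not (leq q p) ∨ isYes (q ≟ᶠ p) ∨ lookup I q)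
  ...   | true  = 1
  ...   | false = 0

  -- T⁻_p(I) = 1 iff p ∈ I and p is maximal in I
  T⁻ : Fin size → Subset size → ℕ
  T⁻ p I with lookup I p
  ... | false = 0
  ... | true with allFinᵇ (λ q → not (leq p q) ∨ isYes (q ≟ᶠ p) ∨ not (lookup I q))
  ...   | true  = 1
  ...   | false = 0

  𝔼 : (Subset size → ℚ) → (Subset size → ℕ) → ℚ
  𝔼 μ f = sumℚ (map (λ I → ℕ→ℚ (f I) * μ I) J)

  IsDistribution : (Subset size → ℚ) → Set
  IsDistribution μ = (∀ I → T (isIdeal I) → 0ℚ ≤ μ I) × sumℚ (map μ J) ≡ ℕ→ℚ 1

  ToggleSymmetric : (Subset size → ℚ) → Set
  ToggleSymmetric μ = ∀ p → 𝔼 μ (T⁺ p) ≡ 𝔼 μ (T⁻ p)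

  -- J(P) is nonempty (the empty set is an ideal), so #J(P) ≠ 0.
  isIdeal-⊥ : isIdeal ⊥ ≡ true
  isIdeal-⊥ = allFinᵇ-true _ λ p → allFinᵇ-true _ λ q → aux p q
    where
      aux : ∀ p q → (not (leq q p) ∨ not (lookup (⊥ {size}) p) ∨ lookup (⊥ {size}) q) ≡ true
      aux p q rewrite lookup-replicate p false = ∨-zeroʳ (not (leq q p))

  #J-nonZero : ℕ.NonZero (length J)
  #J-nonZero with allSubsets-⊥ size
  ... | rest , eq rewrite eq | isIdeal-⊥ = _

  uni : Subset size → ℚ
  uni _ = (+ 1) / length J
    where instance _ = #J-nonZero

  tCDE : Set
  tCDE = ∀ μ → IsDistribution μ → ToggleSymmetric μ → 𝔼 μ ddeg ≡ 𝔼 uni ddeg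

module Submission where

-- Let level 0 = ∅ and let level (k+1) add to level k the minimal elements of its
-- complement; so level k holds the elements at which no chain of k + 1 elements ends,
-- and for P graded of rank r these are the elements of rank < k, with level (r+1) = P.
-- The distribution μ uniform on level 0, …, level (r+1) is toggle-symmetric: an element
-- of rank i can be added only to level i and removed only from level (i+1), the latter
-- because gradedness puts above every element of rank i < r one of rank i + 1.  As
-- ddeg I is the number of maximal elements of I, μ has expected down-degree
-- Σ_k #(elements of rank k − 1) / (r+2) = #P/(r+2), and tCDE transfers this to uni.

open import Defs

open import Data.Bool as Bool using (Bool; true; false; not; _∧_; _∨_; T; if_then_else_)
open import Data.Bool.ListAction using (any)
open import Data.Bool.Properties using (T?; T-≡; ¬-not; ∧-identityʳ)
open import Data.Fin as Fin using (Fin; zero; suc)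
import Data.Fin.Properties as Fin
open import Data.Fin.Subset using (Subset; ⊥; _∈_; _∉_; _⊆_)
open import Data.Fin.Subset.Properties using (⊆-antisym; _∈?_)
open import Data.Integer as ℤ using (+_)
import Data.Integer.Properties as ℤ
open import Data.Integer.Solver using () renaming (module +-*-Solver to ℤ-Solver)
open import Data.List as List using (List; []; _∷_; _++_; map; length; filterᵇ)
import Data.List.Properties as List
open import Data.List.Membership.Propositional using () renaming (_∈_ to _∈ˡ_; _∉_ to _∉ˡ_)
open import Data.List.Membership.Propositional.Properties
  using (∈-++⁺ˡ; ∈-++⁺ʳ; ∈-map⁺; ∈-lookup; ∈-filter⁻; ∈-filter⁺; ∈-∃++)
open import Data.List.Relation.Unary.All as All using (All; []; _∷_)
open import Data.List.Relation.Unary.All.Properties.Core using (¬All⇒Any¬)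
open import Data.List.Relation.Unary.AllPairs using (AllPairs; []; _∷_)
open import Data.List.Relation.Unary.Any using (Any; here; there)
open import Data.List.Relation.Unary.Linked as Linked using (Linked; []; [-]; _∷_)
open import Data.List.Relation.Unary.Linked.Properties using (Linked⇒AllPairs)
open import Data.Nat as ℕ using (ℕ; zero; suc; _+_; _*_; _∸_; _≤_; _<_; z≤n; s≤s; _≤′_; ≤′-refl; ≤′-step)
open import Data.Nat.Properties
open import Algebra.Properties.Semiring.Sum +-*-semiring
  using (sum-syntax; ∑-comm; ∑-distrib-+; sum-cong-≗; sum-replicate-zero; sum-remove; *-distribˡ-sum)
open import Data.Product using (Σ; _×_; _,_; proj₁; proj₂)
open import Data.Rational as ℚ using (ℚ; 0ℚ; _/_; toℚᵘ)
import Data.Rational.Properties as ℚ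
open import Data.Rational.Unnormalised as ℚᵘ using (mkℚᵘ; *≡*)
import Data.Rational.Unnormalised.Properties as ℚᵘ
open import Data.Sum using (_⊎_; inj₁; inj₂)
open import Data.Vec using ([]; _∷_; lookup; tabulate; _[_]≔_)
open import Data.Vec.Properties
  using (≡-dec; []=⇒lookup; lookup⇒[]=; lookup∘update; lookup∘update′; lookup∘tabulate; lookup-replicate)
open import Function using (_∘_; id; Equivalence)
open import Relation.Binary.Definitions using (Transitive; DecidableEquality)
open import Relation.Binary.PropositionalEquality hiding (J)
open import Relation.Nullary using (Dec; yes; no; ¬_; ¬?; contradiction)
open import Relation.Nullary.Decidable using (does; isYes; dec-true; dec-false; _×-dec_; _⊎-dec_)

𝟙 : Bool → ℕ
𝟙 true  = 1
𝟙 false = 0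

∑ˡ : {A : Set} → List A → (A → ℕ) → ℕ
∑ˡ []       f = 0
∑ˡ (x ∷ xs) f = f x + ∑ˡ xs f

module _ {A : Set} where

  ∑ˡ-++ : (xs ys : List A) (f : A → ℕ) → ∑ˡ (xs ++ ys) f ≡ ∑ˡ xs f + ∑ˡ ys f
  ∑ˡ-++ []       ys f = refl
  ∑ˡ-++ (x ∷ xs) ys f = trans (cong (_+_ (f x)) (∑ˡ-++ xs ys f)) (sym (+-assoc (f x) _ _))

  ∑ˡ-map : {B : Set} (g : A → B) (xs : List A) (f : B → ℕ) → ∑ˡ (map g xs) f ≡ ∑ˡ xs (f ∘ g)
  ∑ˡ-map g []       f = refl
  ∑ˡ-map g (x ∷ xs) f = cong (_+_ (f (g x))) (∑ˡ-map g xs f)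

  ∑ˡ-cong-∈ : (xs : List A) {f g : A → ℕ} → (∀ {x} → x ∈ˡ xs → f x ≡ g x) → ∑ˡ xs f ≡ ∑ˡ xs g
  ∑ˡ-cong-∈ []       eq = refl
  ∑ˡ-cong-∈ (x ∷ xs) eq = cong₂ _+_ (eq (here refl)) (∑ˡ-cong-∈ xs (eq ∘ there))

  ∑ˡ-cong : (xs : List A) {f g : A → ℕ} → (∀ x → f x ≡ g x) → ∑ˡ xs f ≡ ∑ˡ xs g
  ∑ˡ-cong xs eq = ∑ˡ-cong-∈ xs λ {x} _ → eq x

  ∑ˡ-zero : (xs : List A) {f : A → ℕ} → (∀ x → f x ≡ 0) → ∑ˡ xs f ≡ 0
  ∑ˡ-zero []       f≡0 = refl
  ∑ˡ-zero (x ∷ xs) f≡0 = cong₂ _+_ (f≡0 x) (∑ˡ-zero xs f≡0)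

  ∑ˡ-filterᵇ : (p : A → Bool) (xs : List A) (f : A → ℕ) →
               ∑ˡ (filterᵇ p xs) f ≡ ∑ˡ xs (λ x → if p x then f x else 0)
  ∑ˡ-filterᵇ p []       f = refl
  ∑ˡ-filterᵇ p (x ∷ xs) f with p x
  ... | true  = cong (_+_ (f x)) (∑ˡ-filterᵇ p xs f)
  ... | false = ∑ˡ-filterᵇ p xs f

  length-filterᵇ : (p : A → Bool) (xs : List A) → length (filterᵇ p xs) ≡ ∑ˡ xs (𝟙 ∘ p)
  length-filterᵇ p []       = refl
  length-filterᵇ p (x ∷ xs) with p x
  ... | true  = cong suc (length-filterᵇ p xs)
  ... | false = length-filterᵇ p xs

  ∑ˡ-∑-comm : ∀ {m} (xs : List A) (f : A → Fin m → ℕ) →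
              ∑ˡ xs (λ x → ∑[ i < m ] f x i) ≡ ∑[ i < m ] ∑ˡ xs (λ x → f x i)
  ∑ˡ-∑-comm {m} []       f = sym (sum-replicate-zero m)
  ∑ˡ-∑-comm     (x ∷ xs) f = trans (cong (_+_ _) (∑ˡ-∑-comm xs f)) (sym (∑-distrib-+ (f x) _))

_≟ˢ_ : ∀ {m} → DecidableEquality (Subset m)
_≟ˢ_ = ≡-dec Bool._≟_

δ : ∀ {m} → Subset m → Subset m → ℕ
δ S A = 𝟙 (does (S ≟ˢ A))

δ-refl : ∀ {m} (A : Subset m) → δ A A ≡ 1
δ-refl A = cong 𝟙 (dec-true (A ≟ˢ A) refl)

δ-≢ : ∀ {m} (A B : Subset m) → A ≢ B → δ A B ≡ 0
δ-≢ A B A≢B = cong 𝟙 (dec-false (A ≟ˢ B) A≢B)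

∑-allSubsets-δ : ∀ m (A : Subset m) (g : Subset m → ℕ) →
                 ∑ˡ (allSubsets m) (λ S → g S * δ S A) ≡ g A
∑-allSubsets-δ zero    [] g = trans (+-identityʳ _) (*-identityʳ (g []))
∑-allSubsets-δ (suc m) (b ∷ A) g = begin
    ∑ˡ (map (false ∷_) subsets ++ map (true ∷_) subsets) h
  ≡⟨ ∑ˡ-++ (map (false ∷_) subsets) _ h ⟩
    ∑ˡ (map (false ∷_) subsets) h + ∑ˡ (map (true ∷_) subsets) h
  ≡⟨ cong₂ _+_ (∑ˡ-map (false ∷_) subsets h) (∑ˡ-map (true ∷_) subsets h) ⟩
    ∑ˡ subsets (h ∘ (false ∷_)) + ∑ˡ subsets (h ∘ (true ∷_))
  ≡⟨ split b ⟩
    g (b ∷ A)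
  ∎
  where
  open ≡-Reasoning
  subsets = allSubsets m
  h : Subset (suc m) → ℕ
  h S = g S * δ S (b ∷ A)
  split : ∀ b → ∑ˡ subsets (λ S → g (false ∷ S) * δ (false ∷ S) (b ∷ A))
              + ∑ˡ subsets (λ S → g (true ∷ S) * δ (true ∷ S) (b ∷ A)) ≡ g (b ∷ A)
  split false = trans (cong₂ _+_ (∑-allSubsets-δ m A (g ∘ (false ∷_)))
                                 (∑ˡ-zero subsets (λ S → *-zeroʳ (g (true ∷ S)))))
                      (+-identityʳ _)
  split true  = trans (cong (_+ ∑ˡ subsets (λ S → g (true ∷ S) * δ S A))
                            (∑ˡ-zero subsets (λ S → *-zeroʳ (g (false ∷ S)))))
                      (∑-allSubsets-δ m A (g ∘ (true ∷_)))

allSubsets-complete : ∀ m (S : Subset m) → S ∈ˡ allSubsets m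
allSubsets-complete zero    []      = here refl
allSubsets-complete (suc m) (false ∷ S) = ∈-++⁺ˡ (∈-map⁺ (false ∷_) (allSubsets-complete m S))
allSubsets-complete (suc m) (true ∷ S)  =
  ∈-++⁺ʳ (map (false ∷_) (allSubsets m)) (∈-map⁺ (true ∷_) (allSubsets-complete m S))

private
  toℚᵘ-/ : ∀ a d → toℚᵘ ((+ a) / suc d) ℚᵘ.≃ mkℚᵘ (+ a) d
  toℚᵘ-/ a d = ℚ.toℚᵘ-fromℚᵘ (mkℚᵘ (+ a) d)

  cross-+ : ∀ a b D → ((+ a) ℤ.* (+ D) ℤ.+ (+ b) ℤ.* (+ D)) ℤ.* (+ D) ≡ (+ (a + b)) ℤ.* (+ (D * D))
  cross-+ a b D =
    trans (solve 3 (λ x y z → (x :* z :+ y :* z) :* z := (x :+ y) :* (z :* z)) refl (+ a) (+ b) (+ D))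
          (sym (cong₂ ℤ._*_ (ℤ.pos-+ a b) (ℤ.pos-* D D)))
    where open ℤ-Solver

  cross-* : ∀ a b D → ((+ a) ℤ.* (+ b)) ℤ.* (+ D) ≡ (+ (a * b)) ℤ.* (+ (1 * D))
  cross-* a b D = cong₂ ℤ._*_ (sym (ℤ.pos-* a b)) (cong +_ (sym (+-identityʳ D)))

/-+ : ∀ a b d → (+ a) / suc d ℚ.+ (+ b) / suc d ≡ (+ (a + b)) / suc d
/-+ a b d = ℚ.toℚᵘ-injective (begin
    toℚᵘ ((+ a) / suc d ℚ.+ (+ b) / suc d)         ≈⟨ ℚ.toℚᵘ-homo-+ ((+ a) / suc d) ((+ b) / suc d) ⟩
    toℚᵘ ((+ a) / suc d) ℚᵘ.+ toℚᵘ ((+ b) / suc d) ≈⟨ ℚᵘ.+-cong (toℚᵘ-/ a d) (toℚᵘ-/ b d) ⟩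
    mkℚᵘ (+ a) d ℚᵘ.+ mkℚᵘ (+ b) d                 ≈⟨ *≡* (cross-+ a b (suc d)) ⟩
    mkℚᵘ (+ (a + b)) d                              ≈⟨ ℚᵘ.≃-sym (toℚᵘ-/ (a + b) d) ⟩
    toℚᵘ ((+ (a + b)) / suc d)                      ∎)
  where open ℚᵘ.≃-Reasoning

ℕ→ℚ-*-/ : ∀ a b d → ℕ→ℚ a ℚ.* ((+ b) / suc d) ≡ (+ (a * b)) / suc d
ℕ→ℚ-*-/ a b d = ℚ.toℚᵘ-injective (begin
    toℚᵘ (ℕ→ℚ a ℚ.* ((+ b) / suc d))         ≈⟨ ℚ.toℚᵘ-homo-* (ℕ→ℚ a) ((+ b) / suc d) ⟩
    toℚᵘ (ℕ→ℚ a) ℚᵘ.* toℚᵘ ((+ b) / suc d)   ≈⟨ ℚᵘ.*-cong (toℚᵘ-/ a 0) (toℚᵘ-/ b d) ⟩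
    mkℚᵘ (+ a) 0 ℚᵘ.* mkℚᵘ (+ b) d            ≈⟨ *≡* (cross-* a b (suc d)) ⟩
    mkℚᵘ (+ (a * b)) d                         ≈⟨ ℚᵘ.≃-sym (toℚᵘ-/ (a * b) d) ⟩
    toℚᵘ ((+ (a * b)) / suc d)                 ∎)
  where open ℚᵘ.≃-Reasoning

0/n≡0 : ∀ d → (+ 0) / suc d ≡ 0ℚ
0/n≡0 d = ℚ.toℚᵘ-injective (ℚᵘ.≃-trans (toℚᵘ-/ 0 d) (*≡* refl))

n/n≡1 : ∀ d → (+ suc d) / suc d ≡ ℕ→ℚ 1
n/n≡1 d = ℚ.toℚᵘ-injective (ℚᵘ.≃-trans (toℚᵘ-/ (suc d) d)
                           (ℚᵘ.≃-trans (*≡* (ℤ.*-comm (+ suc d) (+ 1))) (ℚᵘ.≃-sym (toℚᵘ-/ 1 0))))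

sumℚ-fractions : {A : Set} (xs : List A) (f c : A → ℕ) (d : ℕ) →
  sumℚ (map (λ x → ℕ→ℚ (f x) ℚ.* ((+ c x) / suc d)) xs) ≡ (+ ∑ˡ xs (λ x → f x * c x)) / suc d
sumℚ-fractions []       f c d = sym (0/n≡0 d)
sumℚ-fractions (x ∷ xs) f c d rewrite sumℚ-fractions xs f c d | ℕ→ℚ-*-/ (f x) (c x) d =
  /-+ (f x * c x) (∑ˡ xs (λ x → f x * c x)) d

0≤/ : ∀ a d → 0ℚ ℚ.≤ (+ a) / suc d
0≤/ a d = ℚ.nonNegative⁻¹ _ {{ℚ.normalize-nonNeg a (suc d)}}

∑-zero : ∀ {n} {f : Fin n → ℕ} → (∀ i → f i ≡ 0) → ∑[ i < n ] f i ≡ 0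
∑-zero {n} f≡0 = trans (sum-cong-≗ f≡0) (sum-replicate-zero n)

∑-δ : ∀ {n} (f : Fin n → ℕ) (i₀ : Fin n) → (∀ i → i ≢ i₀ → f i ≡ 0) → ∑[ i < n ] f i ≡ f i₀
∑-δ {suc n} f i₀ f≡0 = trans (sum-remove {i = i₀} f) (trans (cong (_+_ (f i₀)) rest) (+-identityʳ _))
  where rest = ∑-zero (λ j → f≡0 (Fin.punchIn i₀ j) (Fin.punchInᵢ≢i i₀ j))

∑-one : ∀ n → ∑[ i < n ] 1 ≡ n
∑-one zero    = refl
∑-one (suc n) = cong suc (∑-one n)

telescope : ∀ N (g a : ℕ → ℕ) → (∀ {k} → k < N → g k + a k ≡ a (suc k)) →
            ∑[ k < N ] g (Fin.toℕ k) + a 0 ≡ a N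
telescope zero    g a step = refl
telescope (suc N) g a step = begin
    g 0 + ∑[ k < N ] g (suc (Fin.toℕ k)) + a 0    ≡⟨ cong (_+ a 0) (+-comm (g 0) _) ⟩
    ∑[ k < N ] g (suc (Fin.toℕ k)) + g 0 + a 0    ≡⟨ +-assoc _ (g 0) (a 0) ⟩
    ∑[ k < N ] g (suc (Fin.toℕ k)) + (g 0 + a 0)  ≡⟨ cong (_+_ _) (step (s≤s z≤n)) ⟩
    ∑[ k < N ] g (suc (Fin.toℕ k)) + a 1          ≡⟨ telescope N (g ∘ suc) (a ∘ suc) (step ∘ s≤s) ⟩
    a (suc N)                                     ∎
  where open ≡-Reasoning

private
  T⇒≡ : ∀ {b} → T b → b ≡ true
  T⇒≡ = Equivalence.to T-≡

  ≡⇒T : ∀ {b} → b ≡ true → T b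
  ≡⇒T = Equivalence.from T-≡

  not-≡true : ∀ {b} → not b ≡ true → b ≡ false
  not-≡true {false} _ = refl

  not-≡false : ∀ {b} → not b ≡ false → b ≡ true
  not-≡false {true} _ = refl

  ∧-≡true : ∀ {a b} → a ∧ b ≡ true → a ≡ true × b ≡ true
  ∧-≡true {true} e = refl , e

  ∨-≡true : ∀ {a b} → a ∨ b ≡ true → a ≡ true ⊎ b ≡ true
  ∨-≡true {true}  _ = inj₁ refl
  ∨-≡true {false} e = inj₂ e

  ∨-≡false : ∀ {a b} → a ∨ b ≡ false → a ≡ false × b ≡ false
  ∨-≡false {false} e = refl , e

  not-∨-elim : ∀ {a c} → not a ∨ c ≡ true → a ≡ true → c ≡ true
  not-∨-elim e refl = e

  not-∨-false : ∀ {a c} → not a ∨ c ≡ false → a ≡ true × c ≡ false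
  not-∨-false {true} e = refl , e

  not-∨-∨-elim : ∀ {a b c} → not a ∨ b ∨ c ≡ true → a ≡ true → b ≡ false → c ≡ true
  not-∨-∨-elim e refl refl = e

  not-∨-∨-intro : ∀ a b c → (a ≡ true → b ≡ false → c ≡ true) → not a ∨ b ∨ c ≡ true
  not-∨-∨-intro false _     _ _ = refl
  not-∨-∨-intro true  true  _ _ = refl
  not-∨-∨-intro true  false _ h = h refl refl

  isYes-≢ : ∀ {m} {i j : Fin m} → i ≢ j → isYes (i Fin.≟ j) ≡ false
  isYes-≢ {i = i} {j} i≢j with i Fin.≟ j
  ... | yes i≡j = contradiction i≡j i≢j
  ... | no  _   = refl

  isYes≡false : ∀ {m} {i j : Fin m} → isYes (i Fin.≟ j) ≡ false → i ≢ j
  isYes≡false {i = i} {j} e with i Fin.≟ j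
  isYes≡false () | yes _
  ... | no i≢j = i≢j

allFinᵇ-sound : ∀ {m} (f : Fin m → Bool) → allFinᵇ f ≡ true → ∀ i → f i ≡ true
allFinᵇ-sound {suc m} f e i with f zero in f₀
allFinᵇ-sound {suc m} f () _       | false
allFinᵇ-sound {suc m} f e zero    | true = f₀
allFinᵇ-sound {suc m} f e (suc i) | true = allFinᵇ-sound (f ∘ suc) e i

allFinᵇ-false : ∀ {m} (f : Fin m → Bool) → allFinᵇ f ≡ false → Σ (Fin m) λ i → f i ≡ false
allFinᵇ-false {zero}  f ()
allFinᵇ-false {suc m} f e with f zero in f₀
... | false = zero , f₀
... | true  with i , fᵢ ← allFinᵇ-false (f ∘ suc) e = suc i , fᵢ

module _ {m : ℕ} where

  lookup⇒∉ : ∀ {S : Subset m} {i} → lookup S i ≡ false → i ∉ S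
  lookup⇒∉ Sᵢ≡false i∈S with () ← trans (sym ([]=⇒lookup i∈S)) Sᵢ≡false

  ∉⇒lookup : ∀ {S : Subset m} {i} → i ∉ S → lookup S i ≡ false
  ∉⇒lookup {S} {i} i∉S with lookup S i in e
  ... | true  = contradiction (lookup⇒[]= i S e) i∉S
  ... | false = refl

  ⊆ᵇ-sound : ∀ (A B : Subset m) → ⊆ᵇ A B ≡ true → A ⊆ B
  ⊆ᵇ-sound A B e {i} i∈A =
    lookup⇒[]= i B (not-∨-elim (allFinᵇ-sound (λ j → not (lookup A j) ∨ lookup B j) e i) ([]=⇒lookup i∈A))

  ⊆ᵇ-complete : ∀ {A B : Subset m} → A ⊆ B → ⊆ᵇ A B ≡ true
  ⊆ᵇ-complete {A} {B} A⊆B = allFinᵇ-true _ entry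
    where
    entry : ∀ i → not (lookup A i) ∨ lookup B i ≡ true
    entry i with lookup A i in e
    ... | true  = []=⇒lookup (A⊆B (lookup⇒[]= i A e))
    ... | false = refl

  ⊆ᵇ-refute : ∀ {A B : Subset m} {i} → i ∈ A → i ∉ B → ⊆ᵇ A B ≡ false
  ⊆ᵇ-refute {A} {B} i∈A i∉B with ⊆ᵇ A B in e
  ... | true  = contradiction (⊆ᵇ-sound A B e i∈A) i∉B
  ... | false = refl

  ⊂ᵇ-sound : ∀ (A B : Subset m) → ⊂ᵇ A B ≡ true → A ⊆ B × Σ (Fin m) λ i → i ∈ B × i ∉ A
  ⊂ᵇ-sound A B e with A⊆B , B⊈A ← ∧-≡true {⊆ᵇ A B} e with ⊆ᵇ B A in eBA
  ... | true  = contradiction B⊈A λ ()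
  ... | false with i , eᵢ ← allFinᵇ-false _ eBA with B[i]≡true , A[i]≡false ← not-∨-false eᵢ =
    ⊆ᵇ-sound A B A⊆B , i , lookup⇒[]= i B B[i]≡true , lookup⇒∉ A[i]≡false

  ⊂ᵇ-complete : ∀ {A B : Subset m} {i} → A ⊆ B → i ∈ B → i ∉ A → ⊂ᵇ A B ≡ true
  ⊂ᵇ-complete A⊆B i∈B i∉A = cong₂ (λ a b → a ∧ not b) (⊆ᵇ-complete A⊆B) (⊆ᵇ-refute i∈B i∉A)

  ⊂ᵇ-false : ∀ {A B : Subset m} → ⊂ᵇ A B ≡ false → A ⊆ B → B ⊆ A
  ⊂ᵇ-false {A} {B} e A⊆B =
    ⊆ᵇ-sound B A (not-≡false (subst (λ a → a ∧ not (⊆ᵇ B A) ≡ false) (⊆ᵇ-complete A⊆B) e))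

  infixl 5 _∖_

  _∖_ : Subset m → Fin m → Subset m
  S ∖ p = S [ p ]≔ false

  ∖-removes : ∀ S p → p ∉ S ∖ p
  ∖-removes S p = lookup⇒∉ (lookup∘update p S false)

  ∖-keeps : ∀ S {p q} → q ≢ p → lookup (S ∖ p) q ≡ lookup S q
  ∖-keeps S q≢p = lookup∘update′ q≢p S false

  ∖-⊆ : ∀ S p → S ∖ p ⊆ S
  ∖-⊆ S p {q} q∈S∖p with q Fin.≟ p
  ... | yes refl = contradiction q∈S∖p (∖-removes S q)
  ... | no q≢p   = lookup⇒[]= q S (trans (sym (∖-keeps S q≢p)) ([]=⇒lookup q∈S∖p))

  ∖-only : ∀ {S : Subset m} {p x} → x ∈ S → x ∉ S ∖ p → x ≡ p
  ∖-only {S} {p} {x} x∈S x∉S∖p with x Fin.≟ p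
  ... | yes x≡p = x≡p
  ... | no  x≢p = contradiction (lookup⇒[]= x (S ∖ p) (trans (∖-keeps S x≢p) ([]=⇒lookup x∈S))) x∉S∖p

  -- Only p can witness either strict inclusion, and it cannot witness both.
  nothing-strictly-between : ∀ {S : Subset m} {p} → p ∈ S → ∀ K → ⊂ᵇ (S ∖ p) K ∧ ⊂ᵇ K S ≡ false
  nothing-strictly-between {S} {p} p∈S K with ⊂ᵇ (S ∖ p) K in e₁ | ⊂ᵇ K S in e₂
  ... | false | _     = refl
  ... | true  | false = refl
  ... | true  | true
    with S∖p⊆K , y , y∈K , y∉S∖p ← ⊂ᵇ-sound (S ∖ p) K e₁ | K⊆S , z , z∈S , z∉K ← ⊂ᵇ-sound K S e₂
    with refl ← ∖-only (K⊆S y∈K) y∉S∖p | refl ← ∖-only {S} z∈S (z∉K ∘ S∖p⊆K)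
    = contradiction y∈K z∉K

any-≡false : ∀ {A : Set} {f : A → Bool} xs → (∀ x → f x ≡ false) → any f xs ≡ false
any-≡false []       f≡false = refl
any-≡false (x ∷ xs) f≡false rewrite f≡false x = any-≡false xs f≡false

any-≡false⁻ : ∀ {A : Set} {f : A → Bool} xs → any f xs ≡ false → ∀ {x} → x ∈ˡ xs → f x ≡ false
any-≡false⁻ (y ∷ xs) e (here refl) = proj₁ (∨-≡false e)
any-≡false⁻ (y ∷ xs) e (there x∈)  = any-≡false⁻ xs (proj₂ (∨-≡false e)) x∈

Linked-++⁻ʳ : ∀ {A : Set} {R : A → A → Set} (xs : List A) {ys} → Linked R (xs ++ ys) → Linked R ys
Linked-++⁻ʳ []       l = l
Linked-++⁻ʳ (x ∷ xs) l = Linked-++⁻ʳ xs (Linked.tail l)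

module _ {n : ℕ} {R : Fin n → Fin n → Set} (R-trans : Transitive R) (R-irrefl : ∀ {x} → ¬ R x x) where

  private
    AllPairs-lookup : ∀ {xs} → AllPairs R xs → ∀ {i j} → i Fin.< j → R (List.lookup xs i) (List.lookup xs j)
    AllPairs-lookup (Rx ∷ _)  {zero}  {suc j} _         = All.lookup Rx (∈-lookup j)
    AllPairs-lookup (_ ∷ Rxs) {suc i} {suc j} (s≤s i<j) = AllPairs-lookup Rxs i<j

  -- By pigeonhole, a longer list repeats an element, which R then relates to itself.
  Linked-length≤ : ∀ {xs} → Linked R xs → length xs ≤ n
  Linked-length≤ {xs} l with length xs ≤? n
  ... | yes ≤n = ≤n
  ... | no  ≰n with i , j , i<j , xᵢ≡xⱼ ← Fin.pigeonhole (≰⇒> ≰n) (List.lookup xs) =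
    contradiction (subst (λ x → R x _) xᵢ≡xⱼ (AllPairs-lookup (Linked⇒AllPairs R-trans l) i<j)) R-irrefl

module Chains (P : FinPoset) where
  open FinPoset P
  open import Data.List.Membership.DecPropositional (Fin._≟_ {size}) using () renaming (_∈?_ to _∈ˡ?_)

  infix 4 _⊑_ _⊏_ _⊏?_

  _⊑_ _⊏_ : Fin size → Fin size → Set
  _⊑_ = _≼_ P
  _⊏_ = _≺_ P

  ⊏-trans : Transitive _⊏_
  ⊏-trans {x} {y} {z} (x⊑y , x≢y) (y⊑z , _) =
    trans≤ x y z x⊑y y⊑z , λ { refl → x≢y (antisym x y x⊑y y⊑z) }

  ⊏-irrefl : ∀ {x} → ¬ x ⊏ x
  ⊏-irrefl (_ , x≢x) = x≢x refl

  _⊏?_ : ∀ x y → Dec (x ⊏ y)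
  x ⊏? y = T? (leq x y) ×-dec ¬? (x Fin.≟ y)

  comparable? : ∀ x y → Dec (Comparable P x y)
  comparable? x y = T? (leq x y) ⊎-dec T? (leq y x)

  chain-length≤size : ∀ {c} → IsChain P c → length c ≤ size
  chain-length≤size = Linked-length≤ ⊏-trans ⊏-irrefl

  data ChainTo : ℕ → Fin size → Set where
    single : ∀ p → ChainTo 0 p
    _▹_    : ∀ {k q p} → ChainTo k q → q ⊏ p → ChainTo (suc k) p

  chainTo-++ : ∀ {k p} → ChainTo k p → ∀ B → IsChain P (p ∷ B) →
               Σ (List (Fin size)) λ c → IsChain P c × length c ≡ k + suc (length B)
  chainTo-++ (single p) B l = p ∷ B , l , refl
  chainTo-++ {suc k} {p} (c ▹ q⊏p) B l with c′ , l′ , eq ← chainTo-++ c (p ∷ B) (q⊏p ∷ l) =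
    c′ , l′ , trans eq (+-suc k (suc (length B)))

  chainTo-height< : ∀ {k p} → ChainTo k p → k < size
  chainTo-height< {k} c with c′ , l , eq ← chainTo-++ c [] [-] =
    subst (_≤ size) (trans eq (+-comm k 1)) (chain-length≤size l)

  chainTo-prefix : ∀ {k a p B} A → ChainTo k a → Linked _⊏_ (a ∷ A ++ p ∷ B) → ChainTo (k + suc (length A)) p
  chainTo-prefix {k} {p = p} []      c (a⊏p ∷ _) = subst (λ h → ChainTo h p) (+-comm 1 k) (c ▹ a⊏p)
  chainTo-prefix {k} {p = p} (x ∷ A) c (a⊏x ∷ l) =
    subst (λ h → ChainTo h p) (sym (+-suc k (suc (length A)))) (chainTo-prefix A (c ▹ a⊏x) l)

  chainTo-in : ∀ {p B} A → IsChain P (A ++ p ∷ B) → ChainTo (length A) p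
  chainTo-in []      _ = single _
  chainTo-in (a ∷ A) l = chainTo-prefix A (single a) l

  -- Climbing inside Q cannot go on forever: the climb is a chain, whose length is bounded.
  maximal-element : (Q : Fin size → Bool) {x : Fin size} → Q x ≡ true →
                    Σ (Fin size) λ p → Q p ≡ true × (∀ {q} → p ⊏ q → Q q ≡ false)
  maximal-element Q {x} = climb size (single x) refl
    where
    climb : ∀ fuel {k y} → ChainTo k y → k + fuel ≡ size → Q y ≡ true →
            Σ (Fin size) λ p → Q p ≡ true × (∀ {q} → p ⊏ q → Q q ≡ false)
    climb zero {k} c eq _ = contradiction (trans (sym (+-identityʳ k)) eq) (<⇒≢ (chainTo-height< c))
    climb (suc fuel) {k} {y} c eq Qy with Fin.any? (λ q → y ⊏? q ×-dec Q q Bool.≟ true)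
    ... | yes (q , y⊏q , Qq) = climb fuel (c ▹ y⊏q) (trans (sym (+-suc k fuel)) eq) Qq
    ... | no  none           = y , Qy , λ {q} y⊏q → ¬-not (λ Qq → none (q , y⊏q , Qq))

  insert : Fin size → List (Fin size) → List (Fin size)
  insert p []       = p ∷ []
  insert p (x ∷ xs) = if leq p x then p ∷ x ∷ xs else x ∷ insert p xs

  insert-length : ∀ p xs → length (insert p xs) ≡ suc (length xs)
  insert-length p []       = refl
  insert-length p (x ∷ xs) with leq p x
  ... | true  = refl
  ... | false = cong suc (insert-length p xs)

  insert-⊇ : ∀ p {x} xs → x ∈ˡ xs → x ∈ˡ insert p xs
  insert-⊇ p (y ∷ xs) x∈ with leq p y
  insert-⊇ p (y ∷ xs) x∈          | true  = there x∈
  insert-⊇ p (y ∷ xs) (here x≡y)  | false = here x≡y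
  insert-⊇ p (y ∷ xs) (there x∈)  | false = there (insert-⊇ p xs x∈)

  private
    Fresh : Fin size → Fin size → Set
    Fresh p x = Comparable P p x × p ≢ x

    below : ∀ {p x} → Fresh p x → leq p x ≡ false → x ⊏ p
    below (inj₁ p⊑x , _)   p⋢x = contradiction (subst T p⋢x p⊑x) λ ()
    below (inj₂ x⊑p , p≢x) _   = x⊑p , p≢x ∘ sym

    above : ∀ {p x} → Fresh p x → leq p x ≡ true → p ⊏ x
    above (_ , p≢x) p⊑x = subst T (sym p⊑x) _ , p≢x

    insert-chain-above : ∀ {p z xs} → z ⊏ p → Linked _⊏_ (z ∷ xs) → All (Fresh p) xs →
                         Linked _⊏_ (z ∷ insert p xs)
    insert-chain-above {xs = []}         z⊏p _         _          = z⊏p ∷ [-]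
    insert-chain-above {p} {xs = x ∷ xs} z⊏p (z⊏x ∷ l) (fx ∷ fxs) = by-cases (leq p x) refl
      where
      by-cases : ∀ b → leq p x ≡ b → Linked _⊏_ (_ ∷ (if b then p ∷ x ∷ xs else x ∷ insert p xs))
      by-cases true  e = z⊏p ∷ above fx e ∷ l
      by-cases false e = z⊏x ∷ insert-chain-above (below fx e) l fxs

  insert-chain : ∀ {p xs} → IsChain P xs → All (Fresh p) xs → IsChain P (insert p xs)
  insert-chain {xs = []}         _ _          = [-]
  insert-chain {p} {xs = x ∷ xs} l (fx ∷ fxs) = by-cases (leq p x) refl
    where
    by-cases : ∀ b → leq p x ≡ b → IsChain P (if b then p ∷ x ∷ xs else x ∷ insert p xs)
    by-cases true  e = above fx e ∷ l
    by-cases false e = insert-chain-above (below fx e) l fxs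

  MaximalChainThrough : List (Fin size) → Set
  MaximalChainThrough c =
    Σ (List (Fin size)) λ m → IsMaximalChain P m × length c ≤ length m × (∀ {x} → x ∈ˡ c → x ∈ˡ m)

  -- Insert elements comparable to the whole chain until none is left; each insertion
  -- lengthens the chain, so at most size of them happen.
  extend-to-maximal : ∀ {c} → IsChain P c → MaximalChainThrough c
  extend-to-maximal {c} l = grow (suc size ∸ length c) l (m+[n∸m]≡n (m≤n⇒m≤1+n (chain-length≤size l)))
    where
    grow : ∀ fuel {c} → IsChain P c → length c + fuel ≡ suc size → MaximalChainThrough c
    grow zero {c} l eq =
      contradiction (subst (_≤ size) (trans (sym (+-identityʳ _)) eq) (chain-length≤size l)) (n≮n size)
    grow (suc fuel) {c} l eq with Fin.any? (λ p → ¬? (p ∈ˡ? c) ×-dec All.all? (comparable? p) c)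
    ... | no none = c , (l , maximal) , ≤-refl , id
      where
      maximal : ∀ p → p ∉ˡ c → Any (λ x → ¬ Comparable P p x) c
      maximal p p∉c = ¬All⇒Any¬ (comparable? p) c (λ all → none (p , p∉c , all))
    ... | yes (p , p∉c , all) = shrink (grow fuel (insert-chain l fresh) length-eq)
      where
      fresh : All (Fresh p) c
      fresh = All.tabulate λ x∈c → All.lookup all x∈c , λ { refl → p∉c x∈c }
      length-eq : length (insert p c) + fuel ≡ suc size
      length-eq = trans (cong (_+ fuel) (insert-length p c)) (trans (sym (+-suc _ fuel)) eq)
      shrink : MaximalChainThrough (insert p c) → MaximalChainThrough c
      shrink (m , m-max , c′≤m , c′⊆m) =
        m , m-max , ≤-trans (n≤1+n _) (subst (_≤ length m) (insert-length p c) c′≤m) , c′⊆m ∘ insert-⊇ p c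

module Ideals (P : FinPoset) where
  open FinPoset P
  open Chains P

  Ideal : Subset size → Set
  Ideal S = ∀ {p q} → q ⊑ p → p ∈ S → q ∈ S

  isIdeal⇒Ideal : ∀ {S} → T (isIdeal P S) → Ideal S
  isIdeal⇒Ideal {S} t {p} {q} q⊑p p∈S =
    lookup⇒[]= q S (not-∨-∨-elim clause (T⇒≡ q⊑p) (cong not ([]=⇒lookup p∈S)))
    where clause = allFinᵇ-sound _ (allFinᵇ-sound _ (T⇒≡ t) p) q

  Ideal⇒isIdeal : ∀ {S} → Ideal S → T (isIdeal P S)
  Ideal⇒isIdeal {S} ideal = ≡⇒T (allFinᵇ-true _ λ p → allFinᵇ-true _ λ q →
    not-∨-∨-intro (leq q p) (not (lookup S p)) (lookup S q)
      λ q⊑p p∈S → []=⇒lookup (ideal (≡⇒T q⊑p) (lookup⇒[]= p S (not-≡false p∈S))))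

  ∈J⇒Ideal : ∀ {S} → S ∈ˡ J P → Ideal S
  ∈J⇒Ideal S∈J = isIdeal⇒Ideal (proj₂ (∈-filter⁻ (T? ∘ isIdeal P) {xs = allSubsets size} S∈J))

  Ideal⇒∈J : ∀ {S} → Ideal S → S ∈ˡ J P
  Ideal⇒∈J {S} ideal = ∈-filter⁺ (T? ∘ isIdeal P) (allSubsets-complete size S) (Ideal⇒isIdeal ideal)

  ∑-J-δ : ∀ {A} → Ideal A → (g : Subset size → ℕ) → ∑ˡ (J P) (λ S → g S * δ S A) ≡ g A
  ∑-J-δ {A} ideal g = begin
      ∑ˡ (J P) (λ S → g S * δ S A)
    ≡⟨ ∑ˡ-filterᵇ (isIdeal P) (allSubsets size) _ ⟩
      ∑ˡ (allSubsets size) (λ S → if isIdeal P S then g S * δ S A else 0)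
    ≡⟨ ∑ˡ-cong (allSubsets size) (λ S → if-* (isIdeal P S)) ⟩
      ∑ˡ (allSubsets size) (λ S → (if isIdeal P S then g S else 0) * δ S A)
    ≡⟨ ∑-allSubsets-δ size A (λ S → if isIdeal P S then g S else 0) ⟩
      (if isIdeal P A then g A else 0)
    ≡⟨ cong (if_then g A else 0) (T⇒≡ (Ideal⇒isIdeal ideal)) ⟩
      g A
    ∎
    where
    open ≡-Reasoning
    if-* : ∀ {x y} b → (if b then x * y else 0) ≡ (if b then x else 0) * y
    if-* true  = refl
    if-* false = refl

  -- The Boolean tests inside T⁺ and T⁻, verbatim.
  allBelowIn noneAboveIn : Subset size → Fin size → Bool
  allBelowIn  I p = allFinᵇ (λ q → not (leq q p) ∨ isYes (q Fin.≟ p) ∨ lookup I q)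
  noneAboveIn I p = allFinᵇ (λ q → not (leq p q) ∨ isYes (q Fin.≟ p) ∨ not (lookup I q))

  allBelowIn-sound : ∀ {I p q} → allBelowIn I p ≡ true → q ⊏ p → q ∈ I
  allBelowIn-sound {I} {p} {q} e (q⊑p , q≢p) =
    lookup⇒[]= q I (not-∨-∨-elim (allFinᵇ-sound _ e q) (T⇒≡ q⊑p) (isYes-≢ q≢p))

  allBelowIn-false : ∀ {I p} → allBelowIn I p ≡ false → Σ (Fin size) λ q → q ⊏ p × q ∉ I
  allBelowIn-false {I} {p} e with q , e′ ← allFinᵇ-false _ e with q⊑p , rest ← not-∨-false e′
    with q≢p , q∉I ← ∨-≡false {isYes (q Fin.≟ p)} rest = q , (≡⇒T q⊑p , isYes≡false q≢p) , lookup⇒∉ q∉I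

  noneAboveIn-complete : ∀ {I p} → (∀ {q} → p ⊏ q → q ∉ I) → noneAboveIn I p ≡ true
  noneAboveIn-complete {I} {p} max = allFinᵇ-true _ λ q →
    not-∨-∨-intro (leq p q) (isYes (q Fin.≟ p)) (not (lookup I q))
      λ p⊑q q≢p → cong not (∉⇒lookup (max (≡⇒T p⊑q , isYes≡false q≢p ∘ sym)))

  noneAboveIn-sound : ∀ {I p q} → noneAboveIn I p ≡ true → p ⊏ q → q ∉ I
  noneAboveIn-sound {I} {p} {q} e (p⊑q , p≢q) =
    lookup⇒∉ (not-≡true (not-∨-∨-elim (allFinᵇ-sound _ e q) (T⇒≡ p⊑q) (isYes-≢ (p≢q ∘ sym))))

  T⁺+𝟙 : ∀ p I → T⁺ P p I + 𝟙 (lookup I p) ≡ 𝟙 (lookup I p ∨ allBelowIn I p)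
  T⁺+𝟙 p I with lookup I p
  ... | true = refl
  ... | false with allBelowIn I p
  ...   | true  = refl
  ...   | false = refl

  Removable : Subset size → Fin size → Set
  Removable I p = p ∈ I × (∀ {q} → p ⊏ q → q ∉ I)

  T⁻-removable : ∀ {p I} → Removable I p → T⁻ P p I ≡ 1
  T⁻-removable {p} {I} (p∈I , max) with lookup I p | []=⇒lookup p∈I
  ... | true | _ rewrite noneAboveIn-complete max = refl

  T⁻-cases : ∀ p I → T⁻ P p I ≡ 0 ⊎ (T⁻ P p I ≡ 1 × Removable I p)
  T⁻-cases p I with lookup I p in p∈I
  ... | false = inj₁ refl
  ... | true with noneAboveIn I p in max
  ...   | true  = inj₂ (refl , lookup⇒[]= p I p∈I , noneAboveIn-sound max)
  ...   | false = inj₁ refl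

  T⁻-not-removable : ∀ {p I} → ¬ Removable I p → T⁻ P p I ≡ 0
  T⁻-not-removable {p} {I} ¬rem with T⁻-cases p I
  ... | inj₁ T⁻≡0     = T⁻≡0
  ... | inj₂ (_ , rem) = contradiction rem ¬rem

  ∖-ideal : ∀ {I p} → Ideal I → Removable I p → Ideal (I ∖ p)
  ∖-ideal {I} {p} ideal (_ , max) {x} {y} y⊑x x∈I∖p with y Fin.≟ p
  ... | no  y≢p  = lookup⇒[]= y (I ∖ p) (trans (∖-keeps I y≢p) ([]=⇒lookup (ideal y⊑x (∖-⊆ I p x∈I∖p))))
  ... | yes refl with x Fin.≟ y
  ...   | yes refl = x∈I∖p
  ...   | no  x≢y  = contradiction (∖-⊆ I y x∈I∖p) (max (y⊑x , x≢y ∘ sym))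

  ∖-covered : ∀ {I p} → p ∈ I → coversᵇ P (I ∖ p) I ≡ true
  ∖-covered {I} {p} p∈I = cong₂ (λ a b → a ∧ not b)
    (⊂ᵇ-complete (∖-⊆ I p) p∈I (∖-removes I p)) (any-≡false (J P) (nothing-strictly-between p∈I))

  -- A maximal element p of I ∖ S is maximal in I (S being an ideal), and I ∖ p lies
  -- between S and I, so it is S.
  covered⇒∖ : ∀ {I S} → Ideal I → Ideal S → coversᵇ P S I ≡ true →
              Σ (Fin size) λ p → Removable I p × S ≡ I ∖ p
  covered⇒∖ {I} {S} I-ideal S-ideal cov
    with S⊂I , nothing-between ← ∧-≡true {⊂ᵇ S I} cov
    with S⊆I , x , x∈I , x∉S ← ⊂ᵇ-sound S I S⊂I
    with p , Ip∧¬Sp , p-max ← maximal-element (λ i → lookup I i ∧ not (lookup S i))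
                                               (cong₂ (λ a b → a ∧ not b) ([]=⇒lookup x∈I) (∉⇒lookup x∉S))
    with Ip , ¬Sp ← ∧-≡true {lookup I p} Ip∧¬Sp
    = p , removable , ⊆-antisym S⊆I∖p (⊂ᵇ-false S⊂I∖p-false S⊆I∖p)
    where
    p∈I : p ∈ I
    p∈I = lookup⇒[]= p I Ip
    p∉S : p ∉ S
    p∉S = lookup⇒∉ (not-≡true ¬Sp)
    above-in-S : ∀ {q} → p ⊏ q → q ∈ I → q ∈ S
    above-in-S {q} p⊏q q∈I = lookup⇒[]= q S (not-≡false
      (subst (λ a → a ∧ not (lookup S q) ≡ false) ([]=⇒lookup q∈I) (p-max p⊏q)))
    removable : Removable I p
    removable = p∈I , λ p⊏q q∈I → p∉S (S-ideal (proj₁ p⊏q) (above-in-S p⊏q q∈I))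
    S⊆I∖p : S ⊆ I ∖ p
    S⊆I∖p {i} i∈S with i Fin.≟ p
    ... | yes refl = contradiction i∈S p∉S
    ... | no  i≢p  = lookup⇒[]= i (I ∖ p) (trans (∖-keeps I i≢p) ([]=⇒lookup (S⊆I i∈S)))
    S⊂I∖p-false : ⊂ᵇ S (I ∖ p) ≡ false
    S⊂I∖p-false = begin
        ⊂ᵇ S (I ∖ p)                    ≡⟨ sym (∧-identityʳ _) ⟩
        ⊂ᵇ S (I ∖ p) ∧ true             ≡⟨ cong (_∧_ (⊂ᵇ S (I ∖ p))) I∖p⊂I ⟨
        ⊂ᵇ S (I ∖ p) ∧ ⊂ᵇ (I ∖ p) I     ≡⟨ any-≡false⁻ (J P) (not-≡true nothing-between)
                                             (Ideal⇒∈J (∖-ideal I-ideal removable)) ⟩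
        false                            ∎
      where
      open ≡-Reasoning
      I∖p⊂I = ⊂ᵇ-complete (∖-⊆ I p) p∈I (∖-removes I p)

  𝟙-covers : ∀ {I S} → Ideal I → Ideal S → 𝟙 (coversᵇ P S I) ≡ ∑[ p < size ] (T⁻ P p I * δ S (I ∖ p))
  𝟙-covers {I} {S} I-ideal S-ideal with coversᵇ P S I in cov
  ... | true with p₀ , rem₀ , refl ← covered⇒∖ I-ideal S-ideal cov = sym (begin
      ∑[ p < size ] (T⁻ P p I * δ (I ∖ p₀) (I ∖ p))  ≡⟨ ∑-δ _ p₀ others ⟩
      T⁻ P p₀ I * δ (I ∖ p₀) (I ∖ p₀)                ≡⟨ cong₂ _*_ (T⁻-removable rem₀) (δ-refl (I ∖ p₀)) ⟩
      1                                               ∎)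
    where
    open ≡-Reasoning
    others : ∀ p → p ≢ p₀ → T⁻ P p I * δ (I ∖ p₀) (I ∖ p) ≡ 0
    others p p≢p₀ with T⁻-cases p I
    ... | inj₁ T⁻≡0          = cong (_* δ (I ∖ p₀) (I ∖ p)) T⁻≡0
    ... | inj₂ (_ , p∈I , _) =
      trans (cong (_*_ (T⁻ P p I)) (δ-≢ (I ∖ p₀) (I ∖ p) differ)) (*-zeroʳ (T⁻ P p I))
      where
      differ : I ∖ p₀ ≢ I ∖ p
      differ eq = ∖-removes I p (subst (p ∈_) eq
                    (lookup⇒[]= p (I ∖ p₀) (trans (∖-keeps I p≢p₀) ([]=⇒lookup p∈I))))
  ... | false = sym (∑-zero vanish)
    where
    vanish : ∀ p → T⁻ P p I * δ S (I ∖ p) ≡ 0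
    vanish p with T⁻-cases p I
    ... | inj₁ T⁻≡0          = cong (_* δ S (I ∖ p)) T⁻≡0
    ... | inj₂ (_ , p∈I , _) =
      trans (cong (_*_ (T⁻ P p I)) (δ-≢ S (I ∖ p) S≢I∖p)) (*-zeroʳ (T⁻ P p I))
      where
      S≢I∖p : S ≢ I ∖ p
      S≢I∖p refl = contradiction (trans (sym (∖-covered p∈I)) cov) λ ()

  removals-counted : ∀ {I} → Ideal I → ∀ p → ∑ˡ (J P) (λ S → T⁻ P p I * δ S (I ∖ p)) ≡ T⁻ P p I
  removals-counted {I} ideal p with T⁻-cases p I
  ... | inj₁ T⁻≡0      rewrite T⁻≡0 = ∑ˡ-zero (J P) λ _ → refl
  ... | inj₂ (_ , rem)              = ∑-J-δ (∖-ideal ideal rem) (λ _ → T⁻ P p I)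

  ddeg≡∑T⁻ : ∀ {I} → Ideal I → ddeg P I ≡ ∑[ p < size ] T⁻ P p I
  ddeg≡∑T⁻ {I} ideal = begin
      ddeg P I
    ≡⟨ length-filterᵇ (λ S → coversᵇ P S I) (J P) ⟩
      ∑ˡ (J P) (λ S → 𝟙 (coversᵇ P S I))
    ≡⟨ ∑ˡ-cong-∈ (J P) (λ S∈J → 𝟙-covers ideal (∈J⇒Ideal S∈J)) ⟩
      ∑ˡ (J P) (λ S → ∑[ p < size ] (T⁻ P p I * δ S (I ∖ p)))
    ≡⟨ ∑ˡ-∑-comm (J P) (λ S p → T⁻ P p I * δ S (I ∖ p)) ⟩
      ∑[ p < size ] ∑ˡ (J P) (λ S → T⁻ P p I * δ S (I ∖ p))
    ≡⟨ sum-cong-≗ (removals-counted ideal) ⟩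
      ∑[ p < size ] T⁻ P p I
    ∎
    where open ≡-Reasoning

module Levels (P : FinPoset) where
  open FinPoset P
  open Chains P
  open Ideals P

  level : ℕ → Subset size
  level zero    = ⊥
  level (suc k) = tabulate (λ p → lookup (level k) p ∨ allBelowIn (level k) p)

  level-zero : ∀ p → p ∉ level 0
  level-zero p = lookup⇒∉ (lookup-replicate p false)

  lookup-level-suc : ∀ k p → lookup (level (suc k)) p ≡ lookup (level k) p ∨ allBelowIn (level k) p
  lookup-level-suc k p = lookup∘tabulate _ p

  level-⊆-suc : ∀ k → level k ⊆ level (suc k)
  level-⊆-suc k {p} p∈Lₖ = lookup⇒[]= p (level (suc k))
    (trans (lookup-level-suc k p) (cong (_∨ allBelowIn (level k) p) ([]=⇒lookup p∈Lₖ)))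

  level-mono : ∀ {k m} → k ≤ m → level k ⊆ level m
  level-mono k≤m = go (≤⇒≤′ k≤m)
    where
    go : ∀ {k m} → k ≤′ m → level k ⊆ level m
    go ≤′-refl        = id
    go (≤′-step {m} k≤′m) = level-⊆-suc m ∘ go k≤′m

  level-ideal : ∀ k → Ideal (level k)
  level-ideal zero    _ p∈L₀ = contradiction p∈L₀ (level-zero _)
  level-ideal (suc k) {p} {q} q⊑p p∈Lₖ₊₁ with q Fin.≟ p
  ... | yes refl = p∈Lₖ₊₁
  ... | no  q≢p  = level-⊆-suc k q∈Lₖ
    where
    q∈Lₖ : q ∈ level k
    q∈Lₖ with ∨-≡true (trans (sym (lookup-level-suc k p)) ([]=⇒lookup p∈Lₖ₊₁))
    ... | inj₁ p∈Lₖ      = level-ideal k q⊑p (lookup⇒[]= p (level k) p∈Lₖ)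
    ... | inj₂ below-in = allBelowIn-sound {level k} below-in (q⊑p , q≢p)

  ∉level⇒chainTo : ∀ {k p} → p ∉ level k → ChainTo k p
  ∉level⇒chainTo {zero}  {p} _       = single p
  ∉level⇒chainTo {suc k} {p} p∉Lₖ₊₁
    with p∉Lₖ , some-below-out ← ∨-≡false (trans (sym (lookup-level-suc k p)) (∉⇒lookup p∉Lₖ₊₁))
    with q , q⊏p , q∉Lₖ ← allBelowIn-false {level k} some-below-out
    = ∉level⇒chainTo q∉Lₖ ▹ q⊏p

  chainTo⇒∉level : ∀ {k p} → ChainTo k p → p ∉ level k
  chainTo⇒∉level (single p) = level-zero p
  chainTo⇒∉level {suc k} {p} (_▹_ {q = q} c q⊏p) = lookup⇒∉ (trans (lookup-level-suc k p) both-false)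
    where
    q∉Lₖ = chainTo⇒∉level c
    both-false : lookup (level k) p ∨ allBelowIn (level k) p ≡ false
    both-false with lookup (level k) p in p∈Lₖ | allBelowIn (level k) p in below-in
    ... | true  | _     = contradiction (level-ideal k (proj₁ q⊏p) (lookup⇒[]= p (level k) p∈Lₖ)) q∉Lₖ
    ... | false | true  = contradiction (allBelowIn-sound {level k} below-in q⊏p) q∉Lₖ
    ... | false | false = refl

  T⁺-level : ∀ p k → T⁺ P p (level k) + 𝟙 (lookup (level k) p) ≡ 𝟙 (lookup (level (suc k)) p)
  T⁺-level p k = trans (T⁺+𝟙 p (level k)) (cong 𝟙 (sym (lookup-level-suc k p)))

  T⁻-level-new : ∀ {p} k → p ∉ level k → p ∈ level (suc k) → T⁻ P p (level (suc k)) ≡ 1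
  T⁻-level-new k p∉Lₖ p∈Lₖ₊₁ = T⁻-removable (p∈Lₖ₊₁ , λ p⊏q → chainTo⇒∉level (∉level⇒chainTo {k} p∉Lₖ ▹ p⊏q))

  ∑-telescoping : ∀ N p (g : ℕ → ℕ) →
    (∀ {k} → k < N → g k + 𝟙 (lookup (level k) p) ≡ 𝟙 (lookup (level (suc k)) p)) →
    ∑[ k < N ] g (Fin.toℕ k) ≡ 𝟙 (lookup (level N) p)
  ∑-telescoping N p g step = begin
      ∑[ k < N ] g (Fin.toℕ k)
    ≡⟨ +-identityʳ _ ⟨
      ∑[ k < N ] g (Fin.toℕ k) + 0
    ≡⟨ cong (_+_ _ ∘ 𝟙) (∉⇒lookup (level-zero p)) ⟨
      ∑[ k < N ] g (Fin.toℕ k) + 𝟙 (lookup (level 0) p)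
    ≡⟨ telescope N g (λ k → 𝟙 (lookup (level k) p)) step ⟩
      𝟙 (lookup (level N) p)
    ∎
    where open ≡-Reasoning

module GradedLevels (P : FinPoset) (r : ℕ) (graded : Graded P r) where
  open FinPoset P
  open Chains P
  open Ideals P
  open Levels P

  chain-length≤ : ∀ {c} → IsChain P c → length c ≤ suc r
  chain-length≤ {c} l with m , m-max , c≤m , _ ← extend-to-maximal l =
    subst (length c ≤_) (graded m m-max) c≤m

  level-full : ∀ p → p ∈ level (suc r)
  level-full p with p ∈? level (suc r)
  ... | yes p∈ = p∈
  ... | no  p∉ with c , l , eq ← chainTo-++ (∉level⇒chainTo {suc r} p∉) [] [-] =
    contradiction (subst (_≤ suc r) (trans eq (+-comm (suc r) 1)) (chain-length≤ l)) (n≮n (suc r))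

  -- Extend p to a maximal chain A ++ p ∷ B with r + 1 elements.  A is short since p is
  -- low, so B is nonempty; its first element q is low too, since B continues above q.
  upper-neighbour : ∀ {k p} → k ≤ r → p ∈ level k → Σ (Fin size) λ q → p ⊏ q × q ∈ level (suc k)
  upper-neighbour {k} {p} k≤r p∈Lₖ
    with m , m-max , _ , ⊆m ← extend-to-maximal {p ∷ []} [-]
    with A , B , refl ← ∈-∃++ (⊆m (here refl))
    = above B (Linked-++⁻ʳ A (proj₁ m-max)) (trans (sym (List.length-++ A)) (graded _ m-max))
    where
    A<k : length A < k
    A<k with length A <? k
    ... | yes A<k = A<k
    ... | no  A≮k = contradiction (level-mono (≮⇒≥ A≮k) p∈Lₖ) (chainTo⇒∉level (chainTo-in A (proj₁ m-max)))

    above : ∀ B → IsChain P (p ∷ B) → length A + suc (length B) ≡ suc r →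
            Σ (Fin size) λ q → p ⊏ q × q ∈ level (suc k)
    above []        _         eq =
      contradiction (suc-injective (trans (+-comm 1 (length A)) eq)) (<⇒≢ (≤-trans A<k k≤r))
    above (q ∷ B′) (p⊏q ∷ l) eq with q ∈? level (suc k)
    ... | yes q∈ = q , p⊏q , q∈
    ... | no  q∉ with c , lc , c-length ← chainTo-++ (∉level⇒chainTo {suc k} q∉) B′ l =
      contradiction (chain-length≤ lc) (<⇒≱ too-long)
      where
      too-long : suc r < length c
      too-long = begin-strict
        suc r                            ≡⟨ eq ⟨
        length A + suc (suc (length B′)) <⟨ +-monoˡ-< (suc (suc (length B′))) A<k ⟩
        k + suc (suc (length B′))        ≡⟨ +-suc k (suc (length B′)) ⟩
        suc k + suc (length B′)          ≡⟨ c-length ⟨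
        length c                         ∎
        where open ≤-Reasoning

  T⁻-level : ∀ p {k} → k ≤ r → T⁻ P p (level (suc k)) + 𝟙 (lookup (level k) p) ≡ 𝟙 (lookup (level (suc k)) p)
  T⁻-level p {k} k≤r with p ∈? level k
  ... | yes p∈Lₖ with q , p⊏q , q∈Lₖ₊₁ ← upper-neighbour k≤r p∈Lₖ
    rewrite T⁻-not-removable {p} {level (suc k)} (λ (_ , max) → max p⊏q q∈Lₖ₊₁)
          | []=⇒lookup p∈Lₖ | []=⇒lookup (level-⊆-suc k p∈Lₖ) = refl
  ... | no p∉Lₖ with p ∈? level (suc k)
  ...   | yes p∈Lₖ₊₁ rewrite T⁻-level-new k p∉Lₖ p∈Lₖ₊₁ | ∉⇒lookup p∉Lₖ | []=⇒lookup p∈Lₖ₊₁ = refl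
  ...   | no  p∉Lₖ₊₁ rewrite T⁻-not-removable {p} {level (suc k)} (λ (p∈ , _) → p∉Lₖ₊₁ p∈)
                           | ∉⇒lookup p∉Lₖ | ∉⇒lookup p∉Lₖ₊₁ = refl

  N : ℕ
  N = suc (suc r)

  ∑-T⁺-levels : ∀ p → ∑[ k < N ] T⁺ P p (level (Fin.toℕ k)) ≡ 1
  ∑-T⁺-levels p = trans (∑-telescoping N p (λ k → T⁺ P p (level k)) (λ {k} _ → T⁺-level p k))
                        (cong 𝟙 ([]=⇒lookup (level-⊆-suc (suc r) (level-full p))))

  ∑-T⁻-levels : ∀ p → ∑[ k < N ] T⁻ P p (level (Fin.toℕ k)) ≡ 1
  ∑-T⁻-levels p = begin
      T⁻ P p (level 0) + ∑[ k < suc r ] T⁻ P p (level (suc (Fin.toℕ k)))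
    ≡⟨ cong (_+ ∑[ k < suc r ] T⁻ P p (level (suc (Fin.toℕ k)))) T⁻-level-zero ⟩
      ∑[ k < suc r ] T⁻ P p (level (suc (Fin.toℕ k)))
    ≡⟨ ∑-telescoping (suc r) p (λ k → T⁻ P p (level (suc k))) (λ k<r+1 → T⁻-level p (≤-pred k<r+1)) ⟩
      𝟙 (lookup (level (suc r)) p)
    ≡⟨ cong 𝟙 ([]=⇒lookup (level-full p)) ⟩
      1
    ∎
    where
    open ≡-Reasoning
    T⁻-level-zero : T⁻ P p (level 0) ≡ 0
    T⁻-level-zero = T⁻-not-removable {p} {level 0} (λ (p∈ , _) → level-zero p p∈)

module LevelDistribution (P : FinPoset) (r : ℕ) (graded : Graded P r) where
  open FinPoset P
  open Ideals P
  open Levels P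
  open GradedLevels P r graded

  -- μ gives mass 1/(r+2) to each of level 0, …, level (r+1); counting the levels with
  -- multiplicity makes their distinctness irrelevant.
  levelCount : Subset size → ℕ
  levelCount S = ∑[ k < N ] δ S (level (Fin.toℕ k))

  μ : Subset size → ℚ
  μ S = (+ levelCount S) / N

  𝔼-μ : ∀ f → 𝔼 P μ f ≡ (+ ∑[ k < N ] f (level (Fin.toℕ k))) / N
  𝔼-μ f = trans (sumℚ-fractions (J P) f levelCount (suc r)) (cong (λ s → (+ s) / N) (begin
      ∑ˡ (J P) (λ I → f I * levelCount I)
    ≡⟨ ∑ˡ-cong (J P) (λ I → *-distribˡ-sum (f I) (λ (k : Fin N) → δ I (level (Fin.toℕ k)))) ⟩
      ∑ˡ (J P) (λ I → ∑[ k < N ] (f I * δ I (level (Fin.toℕ k))))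
    ≡⟨ ∑ˡ-∑-comm (J P) (λ I (k : Fin N) → f I * δ I (level (Fin.toℕ k))) ⟩
      ∑[ k < N ] ∑ˡ (J P) (λ I → f I * δ I (level (Fin.toℕ k)))
    ≡⟨ sum-cong-≗ (λ (k : Fin N) → ∑-J-δ (level-ideal (Fin.toℕ k)) f) ⟩
      ∑[ k < N ] f (level (Fin.toℕ k))
    ∎))
    where open ≡-Reasoning

  μ-distribution : IsDistribution P μ
  μ-distribution = (λ I _ → 0≤/ (levelCount I) (suc r)) , (begin
      sumℚ (map μ (J P))   ≡⟨ cong sumℚ (List.map-cong (λ I → sym (ℚ.*-identityˡ (μ I))) (J P)) ⟩
      𝔼 P μ (λ _ → 1)      ≡⟨ 𝔼-μ (λ _ → 1) ⟩
      (+ ∑[ k < N ] 1) / N ≡⟨ cong (λ s → (+ s) / N) (∑-one N) ⟩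
      (+ N) / N            ≡⟨ n/n≡1 (suc r) ⟩
      ℕ→ℚ 1                ∎)
    where open ≡-Reasoning

  μ-toggleSymmetric : ToggleSymmetric P μ
  μ-toggleSymmetric p = begin
      𝔼 P μ (T⁺ P p)                                 ≡⟨ 𝔼-μ (T⁺ P p) ⟩
      (+ ∑[ k < N ] T⁺ P p (level (Fin.toℕ k))) / N  ≡⟨ cong (λ s → (+ s) / N) ∑T⁺≡∑T⁻ ⟩
      (+ ∑[ k < N ] T⁻ P p (level (Fin.toℕ k))) / N  ≡⟨ 𝔼-μ (T⁻ P p) ⟨
      𝔼 P μ (T⁻ P p)                                 ∎
    where
    open ≡-Reasoning
    ∑T⁺≡∑T⁻ = trans (∑-T⁺-levels p) (sym (∑-T⁻-levels p))

  𝔼-μ-ddeg : 𝔼 P μ (ddeg P) ≡ (+ size) / N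
  𝔼-μ-ddeg = trans (𝔼-μ (ddeg P)) (cong (λ s → (+ s) / N) (begin
      ∑[ k < N ] ddeg P (level (Fin.toℕ k))
    ≡⟨ sum-cong-≗ (λ (k : Fin N) → ddeg≡∑T⁻ (level-ideal (Fin.toℕ k))) ⟩
      ∑[ k < N ] ∑[ p < size ] T⁻ P p (level (Fin.toℕ k))
    ≡⟨ ∑-comm {N} {size} (λ k p → T⁻ P p (level (Fin.toℕ k))) ⟩
      ∑[ p < size ] ∑[ k < N ] T⁻ P p (level (Fin.toℕ k))
    ≡⟨ sum-cong-≗ ∑-T⁻-levels ⟩
      ∑[ p < size ] 1
    ≡⟨ ∑-one size ⟩
      size
    ∎))
    where open ≡-Reasoning

proposition2p9 : (P : FinPoset) (r : ℕ) → Graded P r → tCDE P →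
    𝔼 P (uni P) (ddeg P) ≡ (+ FinPoset.size P) / suc (suc r)
proposition2p9 P r graded tcde = begin
    𝔼 P (uni P) (ddeg P)               ≡⟨ tcde μ μ-distribution μ-toggleSymmetric ⟨
    𝔼 P μ (ddeg P)                     ≡⟨ 𝔼-μ-ddeg ⟩
    (+ FinPoset.size P) / suc (suc r)  ∎
  where
  open LevelDistribution P r graded
  open ≡-Reasoning
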